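{- Let $q$ be a prime power, let $n\ge 2$, and let $G$ be a finite undirected multigraph (loops and parallel edges allowed) on the vertex set $\{p_1,\dots,p_n\}$ that is the graph representation of a coding scheme over $GF(q)$. Let $H$ be a subgraph of $G$ obtained from $G$ by deleting some edges, keeping all $n$ vertices. Then $H$ is decodable if and only if exactly one of the following holds: (1) $q$ is even and every connected component of $H$ contains a loop; (2) $q$ is odd and every connected component of $H$ contains a cycle of odd length.
   Context: Packets $p_1,\dots,p_n\in GF(q)^\ell$ are to be sent; a coding scheme is a list of encodings, each of which is either $p_j$ or $p_j+p_k$ with $j\neq k$. Its graph representation $G$ has vertices $p_1,\dots,p_n$, one edge joining $p_j$ and $p_k$ for each encoding $p_j+p_k$, and one loop at $p_j$ for each encoding $p_j$ (edges are labelled so that all are distinguishable). A subgraph $H$ (with vertex set $\{p_1,\dots,p_n\}$ and edge multiset contained in that of $G$) is decodable if the linear system formed by the encodings corresponding to the edges of $H$ can be solved for unique $p_1,\dots,p_n$, i.e. the map $(p_1,\dots,p_n)\mapsto(\text{encodings of the edges of }H)$ on $(GF(q)^\ell)^n$ is injective; otherwise $H$ is undecodable. A loop is a cycle of length $1$ and two parallel edges form a cycle of length $2$. An isolated vertex forms a connected component on its own. -}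

module Defs where

open import Level using (Level; _⊔_)
open import Algebra.Bundles using (CommutativeRing)
open import Data.Nat using (ℕ; zero; suc; _^_; _≥_)
open import Data.Nat.Primality using (Prime)
open import Data.Nat.DivMod using (_mod_)
open import Data.Fin using (Fin; toℕ)
open import Data.List using (List; length; lookup)
open import Data.Product using (Σ; ∃; ∃-syntax; _×_)
open import Data.Sum using (_⊎_)
open import Relation.Nullary using (¬_)
open import Relation.Binary.PropositionalEquality using (_≡_; _≢_)
open import Relation.Binary.Construct.Closure.ReflexiveTransitive using (Star)
open import Function.Definitions using (Injective)

record FiniteField (c ℓ : Level) (q : ℕ) : Set (Level.suc (c ⊔ ℓ)) where
  field
    commRing : CommutativeRing c ℓ
  open CommutativeRing commRing public
  field
    1≉0     : ¬ (1# ≈ 0#)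
    inverse : ∀ x → ¬ (x ≈ 0#) → ∃[ y ] (x * y ≈ 1#)
    -- cardinality q: a bijection Carrier/≈ ≅ Fin q
    toFin       : Carrier → Fin q
    fromFin     : Fin q → Carrier
    toFin-cong  : ∀ {x y} → x ≈ y → toFin x ≡ toFin y
    from-to     : ∀ x → fromFin (toFin x) ≈ x
    to-from     : ∀ i → toFin (fromFin i) ≡ i

IsPrimePower : ℕ → Set
IsPrimePower q = ∃[ p ] ∃[ k ] (Prime p × k ≥ 1 × q ≡ p ^ k)

data Encoding (n : ℕ) : Set where
  single : Fin n → Encoding n                     -- encoding p_j (a loop at p_j)
  sum    : (j k : Fin n) → j ≢ k → Encoding n     -- encoding p_j + p_k (edge p_j p_k)

-- A coding scheme (equivalently its graph representation, whose edges
-- are the list positions) is a list of encodings.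
CodingScheme : ℕ → Set
CodingScheme n = List (Encoding n)

module _ {c ℓ : Level} {q : ℕ} (F : FiniteField c ℓ q) where
  open FiniteField F

  Packet : ℕ → Set c
  Packet l = Fin l → Carrier

  _≋_ : ∀ {l} → Packet l → Packet l → Set ℓ
  u ≋ v = ∀ i → u i ≈ v i

  encode : ∀ {n l} → Encoding n → (Fin n → Packet l) → Packet l
  encode (single j)  p = p j
  encode (sum j k _) p = λ i → p j i + p k i

  Decodable : ∀ {n} → (l : ℕ) → CodingScheme n → Set (c ⊔ ℓ)
  Decodable {n} l H =
    (p p' : Fin n → Packet l) →
    (∀ (e : Fin (length H)) → encode (lookup H e) p ≋ encode (lookup H e) p') →
    ∀ j → p j ≋ p' j

Joins : ∀ {n} → Encoding n → Fin n → Fin n → Set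
Joins (single j)  a b = a ≡ j × b ≡ j
Joins (sum j k _) a b = (a ≡ j × b ≡ k) ⊎ (a ≡ k × b ≡ j)

Adj : ∀ {n} → CodingScheme n → Fin n → Fin n → Set
Adj H a b = ∃[ e ] Joins {n = _} (lookup H e) a b

Connected : ∀ {n} → CodingScheme n → Fin n → Fin n → Set
Connected H = Star (Adj H)

next : ∀ {m} → Fin (suc m) → Fin (suc m)
next {m} i = suc (toℕ i) mod suc m

-- A cycle of length m+1 in H: distinct vertices v_0..v_m, distinct edges
-- e_0..e_m of H, edge e_i joining v_i and v_{i+1 mod (m+1)}.
-- (A loop is a cycle of length 1; two parallel edges a cycle of length 2.)
record Cycle {n} (H : CodingScheme n) (m : ℕ) : Set where
  field
    vertex     : Fin (suc m) → Fin n
    edge       : Fin (suc m) → Fin (length H)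
    vertex-inj : Injective _≡_ _≡_ vertex
    edge-inj   : Injective _≡_ _≡_ edge
    joins      : ∀ i → Joins (lookup H (edge i)) (vertex i) (vertex (next i))

-- Decoding is inverting a linear map, so H is decodable iff the only vertex labelling x
-- with x a = 0 at every loop a and x a + x b = 0 along every edge ab is x = 0.  Along a
-- walk such an x alternates in sign: it vanishes on a component containing a loop and,
-- when 1 + 1 is invertible, on one containing an odd closed walk.  Conversely, labelling
-- the component of v by ±1 according to the parity of walks from v (and 0 elsewhere)
-- gives a nonzero kernel element if the component is bipartite, or, when 1 + 1 = 0, if
-- it has no loop.  Counting the fixed points of the involutions x ↦ x + 1 and x ↦ - x
-- shows that 1 + 1 = 0 exactly when q is even.  To decide connectivity and the existence
-- of odd cycles constructively, walks are shortened to length ≤ n by cutting out closed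
-- detours, and an odd closed walk is cut down to a simple odd cycle the same way.

module Submission where

open import Defs
open import Level using (Level; _⊔_)
open import Algebra.Bundles using (Ring)
open import Algebra.Properties.CommutativeSemigroup using (interchange; xy∙z≈xz∙y)
import Algebra.Properties.Ring as RingProperties
open import Data.Fin using (Fin; zero; suc; toℕ; inject₁; fromℕ; punchIn)
open import Data.Fin.Permutation using (permutation)
open import Data.Fin.Properties
  using (_≟_; any?; punchInᵢ≢i; toℕ<n; toℕ-inject₁; toℕ-fromℕ; toℕ-fromℕ<;
         toℕ≤pred[n]; toℕ-injective; injective⇒≤)
open import Data.List as List using (lookup)
open import Data.List.Relation.Binary.Sublist.Propositional using (_⊆_)
open import Data.Nat using (ℕ; zero; suc; _≤_; _<_; _≥_; _%_; z≤n; s≤s; s≤s⁻¹; parity)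
open import Data.Nat.DivMod using (m<n⇒m%n≡m; n%n≡0)
open import Data.Nat.Divisibility using (_∣_; _∣?_; divides; ∣-refl; ∣m∣n⇒∣m+n)
open import Data.Nat.GeneralisedArithmetic using (iterate; fold; iterate-is-fold)
open import Data.Nat.Induction using (<-wellFounded)
open import Data.Nat.Properties using (≤-antisym; ≮⇒≥; <⇒≢; <⇒≤; m≢1+n+m; ≤-refl)
open import Data.Parity.Base as ℙ using (Parity; 0ℙ; 1ℙ; _⁻¹)
import Data.Parity.Properties as ℙₚ
open import Data.Product using (Σ-syntax; ∃-syntax; _×_; _,_)
open import Data.Sum using (_⊎_; inj₁; inj₂)
open import Data.Unit using (⊤; tt)
open import Function using (_∘_)
open import Function.Bundles using (_⇔_; mk⇔)
open import Function.Construct.Composition using (_⇔-∘_)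
open import Function.Definitions using (Injective)
open import Induction.WellFounded using (Acc; acc)
open import Relation.Binary.Construct.Closure.ReflexiveTransitive using (ε; _◅_)
open import Relation.Binary.PropositionalEquality
  using (_≡_; _≢_; refl; sym; trans; cong; cong₂; subst; module ≡-Reasoning)
import Relation.Binary.Reasoning.Setoid as SetoidReasoning
open import Relation.Nullary using (Dec; yes; no; ¬_; contradiction)
open import Relation.Nullary.Decidable using (map′; _×-dec_; _⊎-dec_)

open import Algebra.Properties.CommutativeMonoid.Sum ℙₚ.+-0-commutativeMonoid
  renaming (sum to ∑) using (sum-cong-≗; sum-remove; sum-permute; ∑-distrib-+; sum-replicate-zero)

2∣⇒parity≡0ℙ : ∀ {k} → 2 ∣ k → parity k ≡ 0ℙ
2∣⇒parity≡0ℙ (divides q refl) = trans (ℙₚ.*-homo-* q 2) (ℙₚ.*-zeroʳ (parity q))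

parity≡0ℙ⇒2∣ : ∀ k → parity k ≡ 0ℙ → 2 ∣ k
parity≡0ℙ⇒2∣ zero          _    = divides 0 refl
parity≡0ℙ⇒2∣ (suc (suc k)) even = ∣m∣n⇒∣m+n ∣-refl (parity≡0ℙ⇒2∣ k even)

¬2∣⇒parity≡1ℙ : ∀ k → ¬ 2 ∣ k → parity k ≡ 1ℙ
¬2∣⇒parity≡1ℙ k 2∤k with parity k in eq
... | 0ℙ = contradiction (parity≡0ℙ⇒2∣ k eq) 2∤k
... | 1ℙ = refl

parity≡1ℙ⇒¬2∣ : ∀ {k} → parity k ≡ 1ℙ → ¬ 2 ∣ k
parity≡1ℙ⇒¬2∣ odd 2∣k with () ← trans (sym odd) (2∣⇒parity≡0ℙ 2∣k)

parity-suc : ∀ k → parity (suc k) ≡ parity k ⁻¹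
parity-suc k = ℙₚ.+-homo-+ 1 k

indicator : ∀ {A : Set} → Dec A → Parity
indicator (yes _) = 1ℙ
indicator (no _)  = 0ℙ

∑≡1ℙ : ∀ {N} (f : Fin N → Parity) i → f i ≡ 1ℙ → (∀ j → j ≢ i → f j ≡ 0ℙ) → ∑ f ≡ 1ℙ
∑≡1ℙ {suc N} f i fi≡1ℙ others≡0ℙ = begin
  ∑ f                              ≡⟨ sum-remove f ⟩
  f i ℙ.+ ∑ (λ j → f (punchIn i j))
    ≡⟨ cong₂ ℙ._+_ fi≡1ℙ (sum-cong-≗ {N} (λ j → others≡0ℙ _ (punchInᵢ≢i i j))) ⟩
  1ℙ ℙ.+ ∑ {N} (λ _ → 0ℙ)             ≡⟨ cong (1ℙ ℙ.+_) (sum-replicate-zero N) ⟩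
  1ℙ                                 ∎
  where open ≡-Reasoning

∑1ℙ≡parity : ∀ N → ∑ {N} (λ _ → 1ℙ) ≡ parity N
∑1ℙ≡parity zero    = refl
∑1ℙ≡parity (suc N) = trans (cong (1ℙ ℙ.+_) (∑1ℙ≡parity N)) (sym (parity-suc N))

-- Points moved by an involution come in pairs {i, σ i}, counted once by rising and once by falling.
module _ {N : ℕ} {σ : Fin N → Fin N} (σ-involutive : ∀ i → σ (σ i) ≡ i) where

  open import Data.Fin.Properties using (_<?_; <-cmp; <-asym; <-irrefl)
  open import Relation.Binary.Definitions using (tri<; tri≈; tri>)

  private
    rising falling fixed : Fin N → Parity
    rising  i = indicator (i <? σ i)
    falling i = indicator (σ i <? i)
    fixed   i = indicator (σ i ≟ i)

    trichotomy : ∀ i → rising i ℙ.+ falling i ℙ.+ fixed i ≡ 1ℙ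
    trichotomy i with i <? σ i | σ i <? i | σ i ≟ i
    ... | yes i<σi | yes σi<i | _        = contradiction σi<i (<-asym i<σi)
    ... | yes i<σi | no _     | yes σi≡i = contradiction i<σi (<-irrefl (sym σi≡i))
    ... | yes _    | no _     | no _     = refl
    ... | no _     | yes σi<i | yes σi≡i = contradiction σi<i (<-irrefl σi≡i)
    ... | no _     | yes _    | no _     = refl
    ... | no _     | no _     | yes _    = refl
    ... | no i≮σi  | no σi≮i  | no σi≢i  with <-cmp i (σ i)
    ...   | tri< i<σi _ _ = contradiction i<σi i≮σi
    ...   | tri≈ _ i≡σi _ = contradiction (sym i≡σi) σi≢i
    ...   | tri> _ _ σi<i = contradiction σi<i σi≮i

    falling≡rising∘σ : ∀ i → falling (σ i) ≡ rising i
    falling≡rising∘σ i = cong (λ j → indicator (j <? σ i)) (σ-involutive i)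

    parity≡∑fixed : parity N ≡ ∑ fixed
    parity≡∑fixed = begin
      parity N                                    ≡⟨ ∑1ℙ≡parity N ⟨
      ∑ {N} (λ _ → 1ℙ)                            ≡⟨ sum-cong-≗ trichotomy ⟨
      ∑ (λ i → rising i ℙ.+ falling i ℙ.+ fixed i) ≡⟨ ∑-distrib-+ (λ i → rising i ℙ.+ falling i) fixed ⟩
      ∑ (λ i → rising i ℙ.+ falling i) ℙ.+ ∑ fixed  ≡⟨ cong (ℙ._+ ∑ fixed) (∑-distrib-+ rising falling) ⟩
      ∑ rising ℙ.+ ∑ falling ℙ.+ ∑ fixed           ≡⟨ cong (λ s → ∑ rising ℙ.+ s ℙ.+ ∑ fixed) falling≡rising ⟩
      ∑ rising ℙ.+ ∑ rising ℙ.+ ∑ fixed            ≡⟨ cong (ℙ._+ ∑ fixed) (ℙₚ.p+p≡0ℙ (∑ rising)) ⟩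
      ∑ fixed                                     ∎
      where
      open ≡-Reasoning
      falling≡rising : ∑ falling ≡ ∑ rising
      falling≡rising = trans (sum-permute falling (permutation σ σ σ-involutive σ-involutive))
                             (sum-cong-≗ falling≡rising∘σ)

  fixedPointFree⇒parity≡0ℙ : (∀ i → σ i ≢ i) → parity N ≡ 0ℙ
  fixedPointFree⇒parity≡0ℙ σi≢i =
    trans parity≡∑fixed (trans (sum-cong-≗ {N} not-fixed) (sum-replicate-zero N))
    where
    not-fixed : ∀ i → fixed i ≡ 0ℙ
    not-fixed i with σ i ≟ i
    ... | yes σi≡i = contradiction σi≡i (σi≢i i)
    ... | no _     = refl

  uniqueFixedPoint⇒parity≡1ℙ : ∀ i₀ → σ i₀ ≡ i₀ → (∀ i → σ i ≡ i → i ≡ i₀) → parity N ≡ 1ℙ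
  uniqueFixedPoint⇒parity≡1ℙ i₀ σi₀≡i₀ unique = trans parity≡∑fixed (∑≡1ℙ fixed i₀ fixed-i₀ not-fixed)
    where
    fixed-i₀ : fixed i₀ ≡ 1ℙ
    fixed-i₀ with σ i₀ ≟ i₀
    ... | yes _      = refl
    ... | no σi₀≢i₀  = contradiction σi₀≡i₀ σi₀≢i₀
    not-fixed : ∀ j → j ≢ i₀ → fixed j ≡ 0ℙ
    not-fixed j j≢i₀ with σ j ≟ j
    ... | yes σj≡j = contradiction (unique j σj≡j) j≢i₀
    ... | no _     = refl

module FiniteFieldProperties {c ℓ : Level} {q : ℕ} (F : FiniteField c ℓ q) where

  open FiniteField F hiding (zero)
    renaming (refl to ≈-refl; sym to ≈-sym; trans to ≈-trans; reflexive to ≈-reflexive)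
  open RingProperties ring using (-‿involutive; -0#≈0#; +-identityʳ-unique)
  open SetoidReasoning setoid

  _≈?_ : ∀ x y → Dec (x ≈ y)
  x ≈? y = map′ (λ eq → ≈-trans (≈-sym (from-to x)) (≈-trans (≈-reflexive (cong fromFin eq)) (from-to y)))
                toFin-cong (toFin x ≟ toFin y)

  module _ {σ : Carrier → Carrier} (σ-cong : ∀ {x y} → x ≈ y → σ x ≈ σ y)
           (σ-involutive : ∀ x → σ (σ x) ≈ x) where

    private
      σ̂ : Fin q → Fin q
      σ̂ i = toFin (σ (fromFin i))

      σ̂-involutive : ∀ i → σ̂ (σ̂ i) ≡ i
      σ̂-involutive i = trans (toFin-cong (≈-trans (σ-cong (from-to _)) (σ-involutive _))) (to-from i)

      σ̂-fixed : ∀ {i} → σ̂ i ≡ i → σ (fromFin i) ≈ fromFin i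
      σ̂-fixed {i} eq = ≈-trans (≈-sym (from-to _)) (≈-reflexive (cong fromFin eq))

    fixedPointFree⇒2∣q : (∀ x → ¬ σ x ≈ x) → 2 ∣ q
    fixedPointFree⇒2∣q free = parity≡0ℙ⇒2∣ q
      (fixedPointFree⇒parity≡0ℙ σ̂-involutive (λ i eq → free _ (σ̂-fixed eq)))

    uniqueFixedPoint⇒¬2∣q : ∀ z → σ z ≈ z → (∀ x → σ x ≈ x → x ≈ z) → ¬ 2 ∣ q
    uniqueFixedPoint⇒¬2∣q z σz≈z unique = parity≡1ℙ⇒¬2∣
      (uniqueFixedPoint⇒parity≡1ℙ σ̂-involutive (toFin z) σ̂z≡z σ̂-unique)
      where
      σ̂z≡z : σ̂ (toFin z) ≡ toFin z
      σ̂z≡z = toFin-cong (≈-trans (σ-cong (from-to z)) σz≈z)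
      σ̂-unique : ∀ i → σ̂ i ≡ i → i ≡ toFin z
      σ̂-unique i eq = trans (sym (to-from i)) (toFin-cong (unique _ (σ̂-fixed eq)))

  x+x≈0⇒x≈0 : ¬ 1# + 1# ≈ 0# → ∀ {x} → x + x ≈ 0# → x ≈ 0#
  x+x≈0⇒x≈0 2≉0 {x} x+x≈0 with y , y*2≈1 ← inverse (1# + 1#) 2≉0 = begin
    x                   ≈⟨ *-identityˡ x ⟨
    1# * x              ≈⟨ *-congʳ y*2≈1 ⟨
    (1# + 1#) * y * x   ≈⟨ *-congʳ (*-comm _ y) ⟩
    y * (1# + 1#) * x   ≈⟨ *-assoc y _ x ⟩
    y * ((1# + 1#) * x) ≈⟨ *-congˡ (≈-trans (distribʳ x 1# 1#) (+-cong (*-identityˡ x) (*-identityˡ x))) ⟩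
    y * (x + x)         ≈⟨ *-congˡ x+x≈0 ⟩
    y * 0#              ≈⟨ zeroʳ y ⟩
    0#                  ∎

  1+1≈0⇒2∣q : 1# + 1# ≈ 0# → 2 ∣ q
  1+1≈0⇒2∣q 2≈0 = fixedPointFree⇒2∣q +-congʳ involutive
    (λ x x+1≈x → 1≉0 (+-identityʳ-unique x 1# x+1≈x))
    where
    involutive : ∀ x → x + 1# + 1# ≈ x
    involutive x = ≈-trans (+-assoc x 1# 1#) (≈-trans (+-congˡ 2≈0) (+-identityʳ x))

  1+1≉0⇒¬2∣q : ¬ 1# + 1# ≈ 0# → ¬ 2 ∣ q
  1+1≉0⇒¬2∣q 2≉0 = uniqueFixedPoint⇒¬2∣q -‿cong -‿involutive 0# -0#≈0#
    (λ x -x≈x → x+x≈0⇒x≈0 2≉0 (≈-trans (+-congˡ (≈-sym -x≈x)) (-‿inverseʳ x)))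

  2∣q⇒1+1≈0 : 2 ∣ q → 1# + 1# ≈ 0#
  2∣q⇒1+1≈0 2∣q with (1# + 1#) ≈? 0#
  ... | yes 2≈0 = 2≈0
  ... | no 2≉0  = contradiction 2∣q (1+1≉0⇒¬2∣q 2≉0)

  ¬2∣q⇒1+1≉0 : ¬ 2 ∣ q → ¬ 1# + 1# ≈ 0#
  ¬2∣q⇒1+1≉0 2∤q 2≈0 = 2∤q (1+1≈0⇒2∣q 2≈0)

module _ {m : ℕ} where

  open import Data.Nat using (_<?_)

  next-cases : (i : Fin (suc m)) →
    (toℕ i < m × toℕ (next i) ≡ suc (toℕ i)) ⊎ (toℕ i ≡ m × next i ≡ zero)
  next-cases i with toℕ i <? m
  ... | yes i<m = inj₁ (i<m , trans (toℕ-fromℕ< _) (m<n⇒m%n≡m (s≤s i<m)))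
  ... | no  i≮m = inj₂ (i≡m , toℕ-injective (trans (toℕ-fromℕ< _) wraps))
    where
    i≡m : toℕ i ≡ m
    i≡m = ≤-antisym (toℕ≤pred[n] i) (≮⇒≥ i≮m)
    wraps : suc (toℕ i) % suc m ≡ 0
    wraps = trans (cong (λ k → suc k % suc m) i≡m) (n%n≡0 (suc m))

  iterate-next-wraps : iterate next zero (suc m) ≡ zero
  iterate-next-wraps with next-cases (fold zero next m)
  ... | inj₁ (lt , _)    = contradiction (toℕ-fold m ≤-refl) (<⇒≢ lt)
    where
    toℕ-fold : ∀ k → k ≤ m → toℕ (fold zero next k) ≡ k
    toℕ-fold zero    _         = refl
    toℕ-fold (suc k) k<m with next-cases (fold zero next k)
    ... | inj₁ (_ , eq)     = trans eq (cong suc (toℕ-fold k (<⇒≤ k<m)))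
    ... | inj₂ (last≡m , _) = contradiction (trans (sym (toℕ-fold k (<⇒≤ k<m))) last≡m) (<⇒≢ k<m)
  ... | inj₂ (_ , wraps) = trans (sym (iterate-is-fold zero next (suc m))) wraps

  next∘next≢id : 2 ≤ m → (i : Fin (suc m)) → next (next i) ≢ i
  next∘next≢id 2≤m i eq with next-cases i | next-cases (next i)
  ... | inj₁ (_ , i′≡1+i) | inj₁ (_ , i″≡1+i′) =
    m≢1+n+m (toℕ i) (trans (sym (cong toℕ eq)) (trans i″≡1+i′ (cong suc i′≡1+i)))
  ... | inj₁ (_ , i′≡1+i) | inj₂ (i′≡m , i″≡0) =
    <⇒≢ 2≤m (sym (trans (sym i′≡m) (trans i′≡1+i (cong (suc ∘ toℕ) (trans (sym eq) i″≡0)))))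
  ... | inj₂ (i≡m , i′≡0) | inj₁ (_ , i″≡1+i′) =
    <⇒≢ 2≤m (sym (trans (sym i≡m) (trans (cong toℕ (sym eq)) (trans i″≡1+i′ (cong (suc ∘ toℕ) i′≡0)))))
  ... | inj₂ (_ , i′≡0)   | inj₂ (i′≡m , _) =
    <⇒≢ (<⇒≤ 2≤m) (sym (trans (sym i′≡m) (cong toℕ i′≡0)))

next-swap⇒≡ : ∀ {m} → parity (suc m) ≡ 1ℙ → {i j : Fin (suc m)} → i ≡ next j → next i ≡ j → i ≡ j
next-swap⇒≡ {zero}        _  {zero} {zero} _    _  = refl
next-swap⇒≡ {suc zero}    ()
next-swap⇒≡ {suc (suc m)} _  {j = j}       refl eq = contradiction eq (next∘next≢id (s≤s (s≤s z≤n)) j)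

module Walks {n : ℕ} (H : CodingScheme n) where

  open import Data.Nat using (_+_)
  open import Data.Nat.Properties using (+-comm; +-commutativeSemigroup; m<m+n; m<n⇒m<1+n; anyUpTo?)

  private
    variable
      a b c x : Fin n
      E : Encoding n

  joins-sym : Joins E a b → Joins E b a
  joins-sym {E = single _} (a≡j , b≡j)     = b≡j , a≡j
  joins-sym {E = sum _ _ _} (inj₁ (p , q)) = inj₂ (q , p)
  joins-sym {E = sum _ _ _} (inj₂ (p , q)) = inj₁ (q , p)

  joins? : ∀ (E : Encoding n) a b → Dec (Joins E a b)
  joins? (single j)  a b = (a ≟ j) ×-dec (b ≟ j)
  joins? (sum j k _) a b = ((a ≟ j) ×-dec (b ≟ k)) ⊎-dec ((a ≟ k) ×-dec (b ≟ j))

  joins-unique : Joins E a b → Joins E c x → (a ≡ c × b ≡ x) ⊎ (a ≡ x × b ≡ c)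
  joins-unique {E = single _} (refl , refl) (refl , refl) = inj₁ (refl , refl)
  joins-unique {E = sum _ _ _} (inj₁ (refl , refl)) (inj₁ (refl , refl)) = inj₁ (refl , refl)
  joins-unique {E = sum _ _ _} (inj₁ (refl , refl)) (inj₂ (refl , refl)) = inj₂ (refl , refl)
  joins-unique {E = sum _ _ _} (inj₂ (refl , refl)) (inj₁ (refl , refl)) = inj₂ (refl , refl)
  joins-unique {E = sum _ _ _} (inj₂ (refl , refl)) (inj₂ (refl , refl)) = inj₁ (refl , refl)

  adj-sym : Adj H a b → Adj H b a
  adj-sym (e , j) = e , joins-sym j

  adjacent? : ∀ a b → Dec (Adj H a b)
  adjacent? a b = any? λ e → joins? (lookup H e) a b

  infixr 5 _++_

  data Walk : Fin n → Fin n → Set where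
    []   : Walk a a
    step : (e : Fin (List.length H)) → Joins (lookup H e) a b → Walk b c → Walk a c

  length : Walk a b → ℕ
  length []           = 0
  length (step _ _ w) = suc (length w)

  _++_ : Walk a b → Walk b c → Walk a c
  []           ++ w′ = w′
  step e j w   ++ w′ = step e j (w ++ w′)

  length-++ : (w : Walk a b) (w′ : Walk b c) → length (w ++ w′) ≡ length w + length w′
  length-++ []           w′ = refl
  length-++ (step _ _ w) w′ = cong suc (length-++ w w′)

  _▷_ : Walk a b → Adj H b c → Walk a c
  w ▷ (e , j) = w ++ step e j []

  parity-▷ : (w : Walk a b) (adj : Adj H b c) → parity (length (w ▷ adj)) ≡ parity (length w) ⁻¹
  parity-▷ w adj = trans (cong parity (trans (length-++ w _) (+-comm (length w) 1))) (parity-suc (length w))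

  reverse : Walk a b → Walk b a
  reverse []           = []
  reverse (step e j w) = reverse w ▷ (e , joins-sym j)

  length-reverse : (w : Walk a b) → length (reverse w) ≡ length w
  length-reverse []           = refl
  length-reverse (step e j w) =
    trans (length-++ (reverse w) _) (trans (+-comm _ 1) (cong suc (length-reverse w)))

  walk⇒connected : Walk a b → Connected H a b
  walk⇒connected []           = ε
  walk⇒connected (step e j w) = (e , j) ◅ walk⇒connected w

  vertexAt : (w : Walk a b) → Fin (suc (length w)) → Fin n
  vertexAt {a} []           _       = a
  vertexAt {a} (step _ _ _) zero    = a
  vertexAt     (step _ _ w) (suc i) = vertexAt w i

  source : (w : Walk a b) → Fin (length w) → Fin n
  source w i = vertexAt w (inject₁ i)

  edgeAt : (w : Walk a b) → Fin (length w) → Fin (List.length H)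
  edgeAt (step e _ _) zero    = e
  edgeAt (step _ _ w) (suc i) = edgeAt w i

  edgeAt-joins : (w : Walk a b) (i : Fin (length w)) →
    Joins (lookup H (edgeAt w i)) (source w i) (vertexAt w (suc i))
  edgeAt-joins (step e j [])             zero    = j
  edgeAt-joins (step e j (step _ _ _))   zero    = j
  edgeAt-joins (step _ _ w)              (suc i) = edgeAt-joins w i

  vertexAt-first : (w : Walk a b) → vertexAt w zero ≡ a
  vertexAt-first []           = refl
  vertexAt-first (step _ _ _) = refl

  vertexAt-last : (w : Walk a b) → vertexAt w (fromℕ (length w)) ≡ b
  vertexAt-last []           = refl
  vertexAt-last (step _ _ w) = vertexAt-last w

  Simple : Walk a b → Set
  Simple w = Injective _≡_ _≡_ (source w)

  simple⇒length≤n : (w : Walk a b) → Simple w → length w ≤ n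
  simple⇒length≤n w = injective⇒≤

  splitAt : (w : Walk a b) (i : Fin (suc (length w))) → vertexAt w i ≡ x →
    Σ[ w₁ ∈ Walk a x ] Σ[ w₂ ∈ Walk x b ] (length w₁ ≡ toℕ i × length w₁ + length w₂ ≡ length w)
  splitAt []           zero    refl = [] , [] , refl , refl
  splitAt (step e j w) zero    refl = [] , step e j w , refl , refl
  splitAt (step e j w) (suc i) eq with w₁ , w₂ , length-w₁ , split ← splitAt w i eq =
    step e j w₁ , w₂ , cong suc length-w₁ , cong suc split

  record Detour (w : Walk a b) : Set where
    field
      {pivot}       : Fin n
      before        : Walk a pivot
      loop          : Walk pivot pivot
      after         : Walk pivot b
      length-split  : length before + length loop + length after ≡ length w
      loop-nonempty : 0 < length loop
      loop-shorter  : length loop < length w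

    shortcut : Walk a b
    shortcut = before ++ after

    shortcut+loop : length shortcut + length loop ≡ length w
    shortcut+loop = begin
      length (before ++ after) + length loop          ≡⟨ cong (_+ length loop) (length-++ before after) ⟩
      length before + length after + length loop
        ≡⟨ xy∙z≈xz∙y +-commutativeSemigroup (length before) (length loop) (length after) ⟨
      length before + length loop + length after      ≡⟨ length-split ⟩
      length w                                        ∎
      where open ≡-Reasoning

    shortcut-shorter : length shortcut < length w
    shortcut-shorter = subst (length shortcut <_) shortcut+loop (m<m+n (length shortcut) loop-nonempty)

    shortcut-parity : parity (length loop) ≡ 0ℙ → parity (length shortcut) ≡ parity (length w)
    shortcut-parity loop-even = begin
      parity (length shortcut)                          ≡⟨ ℙₚ.+-identityʳ _ ⟨
      parity (length shortcut) ℙ.+ 0ℙ                   ≡⟨ cong (parity (length shortcut) ℙ.+_) loop-even ⟨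
      parity (length shortcut) ℙ.+ parity (length loop) ≡⟨ ℙₚ.+-homo-+ (length shortcut) (length loop) ⟨
      parity (length shortcut + length loop)            ≡⟨ cong parity shortcut+loop ⟩
      parity (length w)                                 ∎
      where open ≡-Reasoning

  step-detour : ∀ e (j : Joins (lookup H e) a b) {w : Walk b c} → Detour w → Detour (step e j w)
  step-detour e j d = record
    { before        = step e j before
    ; loop          = loop
    ; after         = after
    ; length-split  = cong suc length-split
    ; loop-nonempty = loop-nonempty
    ; loop-shorter  = m<n⇒m<1+n loop-shorter
    }
    where open Detour d

  simpleOrDetour : (w : Walk a b) → Simple w ⊎ Detour w
  simpleOrDetour []           = inj₁ λ { {()} }
  simpleOrDetour (step e j w) with simpleOrDetour w
  ... | inj₂ d = inj₂ (step-detour e j d)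
  simpleOrDetour {a} (step e j w) | inj₁ simple with any? (λ i → source w i ≟ a)
  ... | no  a∉w = inj₁ step-simple
    where
    step-simple : Simple (step e j w)
    step-simple {zero}  {zero}  _  = refl
    step-simple {zero}  {suc k} eq = contradiction (k , sym eq) a∉w
    step-simple {suc i} {zero}  eq = contradiction (i , eq) a∉w
    step-simple {suc i} {suc k} eq = cong suc (simple eq)
  ... | yes (i , eq) with w₁ , w₂ , length-w₁ , split ← splitAt w (inject₁ i) eq = inj₂ (record
    { before        = []
    ; loop          = step e j w₁
    ; after         = w₂
    ; length-split  = cong suc split
    ; loop-nonempty = s≤s z≤n
    ; loop-shorter  = s≤s (subst (_< length w) (sym (trans length-w₁ (toℕ-inject₁ i))) (toℕ<n i))
    })

  simplify : (w : Walk a b) → Σ[ w′ ∈ Walk a b ] Simple w′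
  simplify w = go w (<-wellFounded (length w))
    where
    go : (w : Walk a b) → Acc _<_ (length w) → Σ[ w′ ∈ Walk a b ] Simple w′
    go w (acc shorter) with simpleOrDetour w
    ... | inj₁ simple = w , simple
    ... | inj₂ d      = go (Detour.shortcut d) (shorter (Detour.shortcut-shorter d))

  record OddCycleFrom (a : Fin n) : Set where
    field
      {base} : Fin n
      path   : Walk a base
      cycle  : Walk base base
      simple : Simple cycle
      odd    : parity (length cycle) ≡ 1ℙ

  _◁_ : Walk a b → OddCycleFrom b → OddCycleFrom a
  w ◁ o = record { path = w ++ OddCycleFrom.path o ; OddCycleFrom o hiding (path) }

  -- a detour through an odd loop recurses into the loop, an even one is cut out
  oddClosedWalk⇒OddCycleFrom : (w : Walk a a) → parity (length w) ≡ 1ℙ → OddCycleFrom a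
  oddClosedWalk⇒OddCycleFrom w = go w (<-wellFounded (length w))
    where
    go : (w : Walk a a) → Acc _<_ (length w) → parity (length w) ≡ 1ℙ → OddCycleFrom a
    go w (acc shorter) odd with simpleOrDetour w
    ... | inj₁ simple = record { path = [] ; cycle = w ; simple = simple ; odd = odd }
    ... | inj₂ d with parity (length (Detour.loop d)) in loop-parity
    ...   | 1ℙ = Detour.before d ◁ go (Detour.loop d) (shorter (Detour.loop-shorter d)) loop-parity
    ...   | 0ℙ = go (Detour.shortcut d) (shorter (Detour.shortcut-shorter d))
                    (trans (Detour.shortcut-parity d loop-parity) odd)

  WalkOfLength : ℕ → Fin n → Fin n → Set
  WalkOfLength k a b = Σ[ w ∈ Walk a b ] length w ≡ k

  walkOfLength? : ∀ k a b → Dec (WalkOfLength k a b)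
  walkOfLength? zero a b with a ≟ b
  ... | yes refl = yes ([] , refl)
  ... | no  a≢b  = no λ { ([] , _) → a≢b refl ; (step _ _ _ , ()) }
  walkOfLength? (suc k) a b =
    map′ prepend unprepend (any? λ e → any? λ c → joins? (lookup H e) a c ×-dec walkOfLength? k c b)
    where
    prepend : (∃[ e ] ∃[ c ] (Joins (lookup H e) a c × WalkOfLength k c b)) → WalkOfLength (suc k) a b
    prepend (e , _ , j , w , refl) = step e j w , refl
    unprepend : WalkOfLength (suc k) a b → ∃[ e ] ∃[ c ] (Joins (lookup H e) a c × WalkOfLength k c b)
    unprepend (step e j w , refl) = e , _ , j , w , refl

  ShortWalk : (ℕ → Set) → Fin n → Fin n → Set
  ShortWalk P a b = Σ[ w ∈ Walk a b ] (length w ≤ n × P (length w))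

  shortWalk? : {P : ℕ → Set} → (∀ k → Dec (P k)) → ∀ a b → Dec (ShortWalk P a b)
  shortWalk? {P} P? a b = map′ fromLength toLength (anyUpTo? (λ k → P? k ×-dec walkOfLength? k a b) (suc n))
    where
    fromLength : (∃[ k ] (k < suc n × (P k × WalkOfLength k a b))) → ShortWalk P a b
    fromLength (_ , k<1+n , pk , w , refl) = w , s≤s⁻¹ k<1+n , pk
    toLength : ShortWalk P a b → ∃[ k ] (k < suc n × (P k × WalkOfLength k a b))
    toLength (w , w≤n , pw) = length w , s≤s w≤n , pw , w , refl

  Reachable : Fin n → Fin n → Set
  Reachable = ShortWalk (λ _ → ⊤)

  reachable? : ∀ a b → Dec (Reachable a b)
  reachable? = shortWalk? (λ _ → yes tt)

  ShortOddWalk : Fin n → Fin n → Set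
  ShortOddWalk = ShortWalk (λ k → parity k ≡ 1ℙ)

  shortOddWalk? : ∀ a b → Dec (ShortOddWalk a b)
  shortOddWalk? = shortWalk? (λ k → parity k ℙₚ.≟ 1ℙ)

  walk⇒reachable : Walk a b → Reachable a b
  walk⇒reachable w with w′ , simple ← simplify w = w′ , simple⇒length≤n w′ simple , tt

  reachable-▷ : Reachable a b → Adj H b c → Reachable a c
  reachable-▷ (w , _) adj = walk⇒reachable (w ▷ adj)

  oddCycleFrom⇒short : OddCycleFrom a → ∃[ u ] (Reachable a u × ShortOddWalk u u)
  oddCycleFrom⇒short o = _ , walk⇒reachable path , cycle , simple⇒length≤n cycle simple , odd
    where open OddCycleFrom o

  shortOddClosedWalk⇒OddCycleFrom : Reachable a b → ShortOddWalk b b → OddCycleFrom a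
  shortOddClosedWalk⇒OddCycleFrom (w , _) (c , _ , odd) = w ◁ oddClosedWalk⇒OddCycleFrom c odd

  walks-same-parity : ¬ OddCycleFrom a → (w w′ : Walk a b) → parity (length w) ≡ parity (length w′)
  walks-same-parity noOdd w w′ with parity (length w) ℙₚ.≟ parity (length w′)
  ... | yes same = same
  ... | no differ = contradiction (oddClosedWalk⇒OddCycleFrom (w ++ reverse w′) odd) noOdd
    where
    odd : parity (length (w ++ reverse w′)) ≡ 1ℙ
    odd = begin
      parity (length (w ++ reverse w′))                  ≡⟨ cong parity (length-++ w (reverse w′)) ⟩
      parity (length w + length (reverse w′))            ≡⟨ cong (parity ∘ (length w +_)) (length-reverse w′) ⟩
      parity (length w + length w′)                      ≡⟨ ℙₚ.+-homo-+ (length w) (length w′) ⟩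
      parity (length w) ℙ.+ parity (length w′)           ≡⟨ distinct-sum _ _ differ ⟩
      1ℙ                                                 ∎
      where
      open ≡-Reasoning
      distinct-sum : ∀ p p′ → p ≢ p′ → p ℙ.+ p′ ≡ 1ℙ
      distinct-sum 0ℙ 0ℙ ne = contradiction refl ne
      distinct-sum 0ℙ 1ℙ _  = refl
      distinct-sum 1ℙ 0ℙ _  = refl
      distinct-sum 1ℙ 1ℙ ne = contradiction refl ne

  cycle⇒closedWalk : ∀ {m} (C : Cycle H m) → WalkOfLength (suc m) (Cycle.vertex C zero) (Cycle.vertex C zero)
  cycle⇒closedWalk {m} C =
    around (suc m) zero iterate-next-wraps , length-around (suc m) zero iterate-next-wraps
    where
    open Cycle C
    around : ∀ k i {j} → iterate next i k ≡ j → Walk (vertex i) (vertex j)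
    around zero    i refl = []
    around (suc k) i eq   = step (edge i) (joins i) (around k (next i) eq)
    length-around : ∀ k i {j} (eq : iterate next i k ≡ j) → length (around k i eq) ≡ k
    length-around zero    i refl = refl
    length-around (suc k) i eq   = cong suc (length-around k (next i) eq)

  private
    closedSequence⇒Cycle : ∀ k (V : Fin (suc k) → Fin n) (E : Fin k → Fin (List.length H)) →
      (∀ i → Joins (lookup H (E i)) (V (inject₁ i)) (V (suc i))) → V (fromℕ k) ≡ V zero →
      Injective _≡_ _≡_ (V ∘ inject₁) → parity k ≡ 1ℙ →
      Σ[ m ∈ ℕ ] Σ[ C ∈ Cycle H m ] (¬ 2 ∣ suc m × Cycle.vertex C zero ≡ V zero)
    closedSequence⇒Cycle (suc m) V E V-joins closed injective odd = m , C , parity≡1ℙ⇒¬2∣ odd , refl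
      where
      source′ : Fin (suc m) → Fin n
      source′ = V ∘ inject₁

      V-suc : ∀ i → V (suc i) ≡ source′ (next i)
      V-suc i with next-cases i
      ... | inj₁ (_ , i′≡1+i) = cong V (toℕ-injective (sym (trans (toℕ-inject₁ (next i)) i′≡1+i)))
      ... | inj₂ (i≡m , i′≡0) = begin
        V (suc i)            ≡⟨ cong V (toℕ-injective (trans (cong suc i≡m) (sym (toℕ-fromℕ (suc m))))) ⟩
        V (fromℕ (suc m))    ≡⟨ closed ⟩
        V zero               ≡⟨ cong source′ i′≡0 ⟨
        source′ (next i)     ∎
        where open ≡-Reasoning

      cycle-joins : ∀ i → Joins (lookup H (E i)) (source′ i) (source′ (next i))
      cycle-joins i = subst (Joins (lookup H (E i)) (source′ i)) (V-suc i) (V-joins i)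

      edge-injective : Injective _≡_ _≡_ E
      edge-injective {i} {j} Ei≡Ej
        with joins-unique (cycle-joins i)
               (subst (λ e → Joins (lookup H e) (source′ j) (source′ (next j))) (sym Ei≡Ej) (cycle-joins j))
      ... | inj₁ (same , _)     = injective same
      ... | inj₂ (crossed , crossed′) =
        next-swap⇒≡ odd (injective crossed) (injective crossed′)

      C : Cycle H m
      C = record
        { vertex     = source′
        ; edge       = E
        ; vertex-inj = injective
        ; edge-inj   = edge-injective
        ; joins      = cycle-joins
        }

  simpleOddClosedWalk⇒Cycle : (w : Walk a a) → Simple w → parity (length w) ≡ 1ℙ →
    Σ[ m ∈ ℕ ] Σ[ C ∈ Cycle H m ] (¬ 2 ∣ suc m × Cycle.vertex C zero ≡ a)
  simpleOddClosedWalk⇒Cycle w simple odd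
    with m , C , 2∤1+m , starts ← closedSequence⇒Cycle (length w) (vertexAt w) (edgeAt w) (edgeAt-joins w)
                                    (trans (vertexAt-last w) (sym (vertexAt-first w))) simple odd
    = m , C , 2∤1+m , trans starts (vertexAt-first w)

  EveryComponentHasLoop : Set
  EveryComponentHasLoop = ∀ v → ∃[ u ] (Connected H v u × Adj H u u)

  HasOddCycle : Fin n → Set
  HasOddCycle v = ∃[ m ] ∃[ C ] (¬ (2 ∣ suc m) × Connected H v (Cycle.vertex {H = H} {m = m} C zero))

  EveryComponentHasOddCycle : Set
  EveryComponentHasOddCycle = ∀ v → HasOddCycle v

  oddCycleFrom⇒Cycle : OddCycleFrom a → HasOddCycle a
  oddCycleFrom⇒Cycle record { path = path ; cycle = cycle ; simple = simple ; odd = odd }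
    with m , C , 2∤1+m , starts ← simpleOddClosedWalk⇒Cycle cycle simple odd =
    m , C , 2∤1+m , subst (Connected H _) (sym starts) (walk⇒connected path)

module Kernel {c ℓ : Level} (R : Ring c ℓ) {n : ℕ} (H : CodingScheme n) where

  open Ring R hiding (zero)
    renaming (refl to ≈-refl; sym to ≈-sym; trans to ≈-trans; reflexive to ≈-reflexive)
  open RingProperties R using (-0#≈0#; -‿involutive; +-inverseˡ-unique; -‿+-comm)
  open SetoidReasoning setoid
  open Walks H

  private
    variable
      a b : Fin n
      x : Fin n → Carrier

  value : (Fin n → Carrier) → Encoding n → Carrier
  value x (single a)  = x a
  value x (sum a b _) = x a + x b

  InKernel : (Fin n → Carrier) → Set ℓ
  InKernel x = ∀ e → value x (lookup H e) ≈ 0#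

  KernelTrivial : Set (c ⊔ ℓ)
  KernelTrivial = ∀ x → InKernel x → ∀ v → x v ≈ 0#

  kernel-loop : InKernel x → Adj H a a → x a ≈ 0#
  kernel-loop {x} inKernel (e , j) = vanishes (lookup H e) j (inKernel e)
    where
    vanishes : ∀ E → Joins E a a → value x E ≈ 0# → x a ≈ 0#
    vanishes (single _)    (refl , _)           xa≈0 = xa≈0
    vanishes (sum _ _ j≢k) (inj₁ (refl , refl)) _    = contradiction refl j≢k
    vanishes (sum _ _ j≢k) (inj₂ (refl , refl)) _    = contradiction refl j≢k

  kernel-edge : InKernel x → Adj H a b → x a + x b ≈ 0#
  kernel-edge {x} inKernel (e , j) = cancels (lookup H e) j (inKernel e)
    where
    cancels : ∀ E → Joins E a b → value x E ≈ 0# → x a + x b ≈ 0#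
    cancels (single _)  (refl , refl)        xa≈0  = ≈-trans (+-cong xa≈0 xa≈0) (+-identityˡ 0#)
    cancels (sum _ _ _) (inj₁ (refl , refl)) sum≈0 = sum≈0
    cancels (sum _ _ _) (inj₂ (refl , refl)) sum≈0 = ≈-trans (+-comm _ _) sum≈0

  inKernel : (∀ {a} → Adj H a a → x a ≈ 0#) → (∀ {a b} → Adj H a b → x a + x b ≈ 0#) → InKernel x
  inKernel {x} loops edges e = vanishes (lookup H e) (e ,_)
    where
    vanishes : ∀ E → (∀ {a b} → Joins E a b → Adj H a b) → value x E ≈ 0#
    vanishes (single _)  adj = loops (adj (refl , refl))
    vanishes (sum _ _ _) adj = edges (adj (inj₁ (refl , refl)))

  kernel-connected : InKernel x → Connected H a b → x b ≈ 0# → x a ≈ 0#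
  kernel-connected         inKernel ε            xb≈0 = xb≈0
  kernel-connected {x} {a} inKernel (adj ◅ path) xb≈0 = begin
    x a   ≈⟨ +-inverseˡ-unique _ _ (kernel-edge inKernel adj) ⟩
    - x _ ≈⟨ -‿cong (kernel-connected inKernel path xb≈0) ⟩
    - 0#  ≈⟨ -0#≈0# ⟩
    0#    ∎

  alternate : Parity → Carrier → Carrier
  alternate 0ℙ y = y
  alternate 1ℙ y = - y

  kernel-walk : InKernel x → (w : Walk a b) → x a ≈ alternate (parity (length w)) (x b)
  kernel-walk inKernel []                       = ≈-refl
  kernel-walk {x} {a} {b} inKernel (step e j w) = begin
    x a                                       ≈⟨ +-inverseˡ-unique _ _ (kernel-edge inKernel (e , j)) ⟩
    - x _                                     ≈⟨ -‿cong (kernel-walk inKernel w) ⟩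
    - alternate (parity (length w)) (x b)     ≈⟨ -alternate (parity (length w)) ⟩
    alternate (parity (length w) ⁻¹) (x b)    ≡⟨ cong (λ π → alternate π (x b)) (parity-suc (length w)) ⟨
    alternate (parity (suc (length w))) (x b) ∎
    where
    -alternate : ∀ π → - alternate π (x b) ≈ alternate (π ⁻¹) (x b)
    -alternate 0ℙ = ≈-refl
    -alternate 1ℙ = -‿involutive (x b)

  kernel-oddClosedWalk : InKernel x → (w : Walk a a) → parity (length w) ≡ 1ℙ → x a + x a ≈ 0#
  kernel-oddClosedWalk {x} {a} inKernel w odd = begin
    x a + x a                                 ≈⟨ +-congʳ (kernel-walk inKernel w) ⟩
    alternate (parity (length w)) (x a) + x a ≡⟨ cong (λ π → alternate π (x a) + x a) odd ⟩
    - x a + x a                               ≈⟨ -‿inverseˡ (x a) ⟩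
    0#                                        ∎

  loops⇒kernelTrivial : EveryComponentHasLoop → KernelTrivial
  loops⇒kernelTrivial loops x inKernel v with _ , path , loop ← loops v =
    kernel-connected inKernel path (kernel-loop inKernel loop)

  oddCycles⇒kernelTrivial : (∀ {y} → y + y ≈ 0# → y ≈ 0#) → EveryComponentHasOddCycle → KernelTrivial
  oddCycles⇒kernelTrivial halve cycles x inKernel v with m , C , 2∤1+m , path ← cycles v
    with w , length-w ← cycle⇒closedWalk C =
    kernel-connected inKernel path
      (halve (kernel-oddClosedWalk inKernel w (trans (cong parity length-w) (¬2∣⇒parity≡1ℙ (suc m) 2∤1+m))))

  module Colouring (v : Fin n) where

    signOf : Parity → Carrier
    signOf 0ℙ = 1#
    signOf 1ℙ = - 1#

    colourOf : Dec (Reachable v a) → Carrier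
    colourOf (yes (w , _)) = signOf (parity (length w))
    colourOf (no _)        = 0#

    colouring : Fin n → Carrier
    colouring a = colourOf (reachable? v a)

    colouring-inKernel :
      (∀ {a b} → Adj H a b → (w : Walk v a) (w′ : Walk v b) →
         signOf (parity (length w)) + signOf (parity (length w′)) ≈ 0#) →
      (∀ {a} → Adj H a a → ¬ Reachable v a) →
      InKernel colouring
    colouring-inKernel signs-cancel unreachable-loops =
      inKernel (λ loop → loop-colour loop (reachable? v _))
               (λ adj → edge-colours adj (reachable? v _) (reachable? v _))
      where
      loop-colour : Adj H a a → (r : Dec (Reachable v a)) → colourOf r ≈ 0#
      loop-colour loop (yes r) = contradiction r (unreachable-loops loop)
      loop-colour loop (no _)  = ≈-refl
      edge-colours : Adj H a b → (r : Dec (Reachable v a)) (r′ : Dec (Reachable v b)) →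
        colourOf r + colourOf r′ ≈ 0#
      edge-colours adj (yes (w , _)) (yes (w′ , _)) = signs-cancel adj w w′
      edge-colours adj (yes r)       (no ¬r′)       = contradiction (reachable-▷ r adj) ¬r′
      edge-colours adj (no ¬r)       (yes r′)       = contradiction (reachable-▷ r′ (adj-sym adj)) ¬r
      edge-colours adj (no _)        (no _)         = +-identityˡ 0#

    colouring-source : ¬ 1# ≈ 0# → ¬ colouring v ≈ 0#
    colouring-source 1≉0 = colourOf-source (reachable? v v)
      where
      colourOf-source : (r : Dec (Reachable v v)) → ¬ colourOf r ≈ 0#
      colourOf-source (yes (w , _)) with parity (length w)
      ... | 0ℙ = 1≉0
      ... | 1ℙ = λ -1≈0 → 1≉0 (≈-trans (≈-sym (-‿involutive 1#)) (≈-trans (-‿cong -1≈0) -0#≈0#))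
      colourOf-source (no unreachable) = contradiction ([] , z≤n , tt) unreachable

  kernelTrivial⇒loops : 1# + 1# ≈ 0# → ¬ 1# ≈ 0# → KernelTrivial → EveryComponentHasLoop
  kernelTrivial⇒loops 2≈0 1≉0 trivial v with any? (λ u → reachable? v u ×-dec adjacent? u u)
  ... | yes (u , (w , _) , loop) = u , walk⇒connected w , loop
  ... | no noLoop = contradiction (trivial colouring (colouring-inKernel signs-cancel unreachable-loops) v)
                                  (colouring-source 1≉0)
    where
    open Colouring v
    signOf-+ : ∀ π π′ → signOf π + signOf π′ ≈ 0#
    signOf-+ 0ℙ 0ℙ = 2≈0
    signOf-+ 0ℙ 1ℙ = -‿inverseʳ 1#
    signOf-+ 1ℙ 0ℙ = -‿inverseˡ 1#
    signOf-+ 1ℙ 1ℙ = ≈-trans (-‿+-comm 1# 1#) (≈-trans (-‿cong 2≈0) -0#≈0#)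
    signs-cancel : ∀ {a b} → Adj H a b → (w : Walk v a) (w′ : Walk v b) →
      signOf (parity (length w)) + signOf (parity (length w′)) ≈ 0#
    signs-cancel _ w w′ = signOf-+ (parity (length w)) (parity (length w′))
    unreachable-loops : ∀ {a} → Adj H a a → ¬ Reachable v a
    unreachable-loops loop r = noLoop (_ , r , loop)

  kernelTrivial⇒oddCycles : ¬ 1# ≈ 0# → KernelTrivial → EveryComponentHasOddCycle
  kernelTrivial⇒oddCycles 1≉0 trivial v with any? (λ u → reachable? v u ×-dec shortOddWalk? u u)
  ... | yes (_ , r , short-odd) = oddCycleFrom⇒Cycle (shortOddClosedWalk⇒OddCycleFrom r short-odd)
  ... | no noOddCycle = contradiction (trivial colouring (colouring-inKernel signs-cancel unreachable-loops) v)
                                      (colouring-source 1≉0)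
    where
    open Colouring v
    bipartite : ¬ OddCycleFrom v
    bipartite oddCycle = noOddCycle (oddCycleFrom⇒short oddCycle)
    signOf-opposite : ∀ π → signOf π + signOf (π ⁻¹) ≈ 0#
    signOf-opposite 0ℙ = -‿inverseʳ 1#
    signOf-opposite 1ℙ = -‿inverseˡ 1#
    signs-cancel : ∀ {a b} → Adj H a b → (w : Walk v a) (w′ : Walk v b) →
      signOf (parity (length w)) + signOf (parity (length w′)) ≈ 0#
    signs-cancel adj w w′ = ≈-trans
      (+-congˡ (≈-reflexive (cong signOf (trans (walks-same-parity bipartite w′ (w ▷ adj)) (parity-▷ w adj)))))
      (signOf-opposite (parity (length w)))
    unreachable-loops : ∀ {a} → Adj H a a → ¬ Reachable v a
    unreachable-loops loop (w , _) =
      ℙₚ.p≢p⁻¹ _ (trans (walks-same-parity bipartite w (w ▷ loop)) (parity-▷ w loop))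

module _ {c ℓ : Level} {q : ℕ} (F : FiniteField c ℓ q) {n : ℕ} (H : CodingScheme n) where

  open FiniteField F
    renaming (refl to ≈-refl; sym to ≈-sym; trans to ≈-trans; reflexive to ≈-reflexive)
  open RingProperties ring using (-‿+-comm; x∙y⁻¹≈ε⇒x≈y; x≈y⇒x∙y⁻¹≈ε)
  open SetoidReasoning setoid
  open FiniteFieldProperties F
  open Walks H using (EveryComponentHasLoop; EveryComponentHasOddCycle)
  open Kernel ring H

  private
    encode≡value : ∀ {l} E (p : Fin n → Packet F l) i → encode F E p i ≡ value (λ v → p v i) E
    encode≡value (single _)  p i = refl
    encode≡value (sum _ _ _) p i = refl

    value-difference : ∀ E (x y : Fin n → Carrier) → value (λ v → x v - y v) E ≈ value x E - value y E
    value-difference (single _)  x y = ≈-refl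
    value-difference (sum a b _) x y =
      ≈-trans (interchange +-commutativeSemigroup (x a) (- y a) (x b) (- y b)) (+-congˡ (-‿+-comm (y a) (y b)))

    value-zero : ∀ E → value (λ _ → 0#) E ≈ 0#
    value-zero (single _)  = ≈-refl
    value-zero (sum _ _ _) = +-identityˡ 0#

  decodable⇔kernelTrivial : ∀ {l} → Fin l → Decodable F l H ⇔ KernelTrivial
  decodable⇔kernelTrivial i₀ = mk⇔ necessary sufficient
    where
    necessary : Decodable F _ H → KernelTrivial
    necessary decodable x inKernel v = decodable (λ u _ → x u) (λ _ _ → 0#) agree v i₀
      where
      agree : ∀ e → _≋_ F (encode F (lookup H e) (λ u _ → x u)) (encode F (lookup H e) (λ _ _ → 0#))
      agree e i = begin
        encode F (lookup H e) (λ u _ → x u) i    ≡⟨ encode≡value (lookup H e) (λ u _ → x u) i ⟩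
        value x (lookup H e)                     ≈⟨ inKernel e ⟩
        0#                                       ≈⟨ value-zero (lookup H e) ⟨
        value (λ _ → 0#) (lookup H e)            ≡⟨ encode≡value (lookup H e) (λ _ _ → 0#) i ⟨
        encode F (lookup H e) (λ _ _ → 0#) i     ∎

    sufficient : KernelTrivial → Decodable F _ H
    sufficient trivial p p′ agree v i = x∙y⁻¹≈ε⇒x≈y _ _ (trivial difference difference-inKernel v)
      where
      difference : Fin n → Carrier
      difference u = p u i - p′ u i
      difference-inKernel : InKernel difference
      difference-inKernel e = begin
        value difference (lookup H e)                                         ≈⟨ value-difference (lookup H e) _ _ ⟩
        value (λ u → p u i) (lookup H e) - value (λ u → p′ u i) (lookup H e)  ≈⟨ x≈y⇒x∙y⁻¹≈ε equal ⟩
        0#                                                                    ∎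
        where
        equal : value (λ u → p u i) (lookup H e) ≈ value (λ u → p′ u i) (lookup H e)
        equal = begin
          value (λ u → p u i) (lookup H e)   ≡⟨ encode≡value (lookup H e) p i ⟨
          encode F (lookup H e) p i          ≈⟨ agree e i ⟩
          encode F (lookup H e) p′ i         ≡⟨ encode≡value (lookup H e) p′ i ⟩
          value (λ u → p′ u i) (lookup H e)  ∎

  LoopsOrOddCycles : Set
  LoopsOrOddCycles = (2 ∣ q × EveryComponentHasLoop) ⊎ (¬ (2 ∣ q) × EveryComponentHasOddCycle)

  kernelTrivial⇔loopsOrOddCycles : KernelTrivial ⇔ LoopsOrOddCycles
  kernelTrivial⇔loopsOrOddCycles = mk⇔ necessary sufficient
    where
    necessary : KernelTrivial → LoopsOrOddCycles
    necessary trivial with 2 ∣? q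
    ... | yes 2∣q = inj₁ (2∣q , kernelTrivial⇒loops (2∣q⇒1+1≈0 2∣q) 1≉0 trivial)
    ... | no  2∤q = inj₂ (2∤q , kernelTrivial⇒oddCycles 1≉0 trivial)

    sufficient : LoopsOrOddCycles → KernelTrivial
    sufficient (inj₁ (_ , loops))    = loops⇒kernelTrivial loops
    sufficient (inj₂ (2∤q , cycles)) = oddCycles⇒kernelTrivial (x+x≈0⇒x≈0 (¬2∣q⇒1+1≉0 2∤q)) cycles

theorem3 : ∀ {c ℓ : Level} (q : ℕ) → IsPrimePower q → (F : FiniteField c ℓ q) →
    (l : ℕ) → l ≥ 1 → (n : ℕ) → n ≥ 2 →
    (G H : CodingScheme n) → H ⊆ G →
    Decodable F l H ⇔
      ((2 ∣ q × (∀ v → ∃[ u ] (Connected H v u × Adj H u u)))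
       ⊎ (¬ (2 ∣ q) × (∀ v → ∃[ m ] ∃[ C ] (¬ (2 ∣ suc m) × Connected H v (Cycle.vertex {H = H} {m = m} C zero)))))
theorem3 _ _ F (suc _) _ _ _ _ H _ = kernelTrivial⇔loopsOrOddCycles F H ⇔-∘ decodable⇔kernelTrivial F H zero
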